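{- For every prime $p$, every positive integer $x$ and every positive integer $n$, \[ \nu_p\bigl(sf^{(n)}(x)\bigr)=\sum_{i=1}^{x}\left[P_{n-1}(x+1-i)\sum_{k=1}^{\infty}\left\lfloor \frac{i}{p^{k}}\right\rfloor\right]. \]
   Context: $\nu_p(m)$ denotes the $p$-adic valuation (exponent of $p$ in the factorization) of a positive integer $m$. For integers $r\ge 0$ and $m\ge 1$, $P_r(m)=\binom{m+r-1}{r}$ is the $r$-simplex (figurate) number (so $P_0(m)=1$). The generalized superfactorial is defined for positive integers $x$ by $sf^{(0)}(x)=x!$ and $sf^{(n)}(x)=\prod_{k=1}^{x}sf^{(n-1)}(k)$ for $n\ge 1$. -}

module Defs where

open import Data.Nat using (ℕ; zero; suc; _+_; _*_; _∸_; _^_; _!; NonZero)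
open import Data.Nat.Divisibility using (_∣_)
open import Data.Nat.DivMod using (_/_)
open import Data.Product using (_×_)
open import Relation.Nullary using (¬_)
open import Data.Nat.Combinatorics using (_C_)

sumTo : ℕ → (ℕ → ℕ) → ℕ
sumTo zero    f = 0
sumTo (suc x) f = sumTo x f + f (suc x)

prodTo : ℕ → (ℕ → ℕ) → ℕ
prodTo zero    f = 1
prodTo (suc x) f = prodTo x f * f (suc x)

sf : ℕ → ℕ → ℕ
sf zero    x = x !
sf (suc n) x = prodTo x (sf n)

P : ℕ → ℕ → ℕ
P r m = (m + r ∸ 1) C r

IsValuation : ℕ → ℕ → ℕ → Set
IsValuation p m v = (p ^ v ∣ m) × ¬ (p ^ suc v ∣ m)

-- Σ_{k=1}^{∞} ⌊i / p^k⌋ for a prime p.  For k > i we have p^k > i, so the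
-- terms with k > i vanish; the infinite sum equals the finite sum up to k = i.
legendreSum : (p : ℕ) → .{{NonZero p}} → ℕ → ℕ
legendreSum p i = sumTo i (λ k → _/_ i (p ^ k) {{m^n≢0 p k}})
  where
  open import Data.Nat.Properties using (m^n≢0)

{-# OPTIONS --safe #-}
module Submission where

-- ν_p is additive, so ν_p(sf⁽ʳ⁺¹⁾(x)) is the partial sum over k ≤ x of
-- ν_p(sf⁽ʳ⁾(k)).  At the bottom, Legendre's formula ν_p(x!) = Σ_k ⌊x/pᵏ⌋
-- holds because ⌊(x+1)/q⌋ exceeds ⌊x/q⌋ exactly when q ∣ x+1, and the number
-- of k with pᵏ ∣ x+1 is ν_p(x+1).  Each further partial sum turns the weights
-- P_r(x+1-i) into P_{r+1}(x+1-i) by Pascal's rule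
-- P_{r+1}(m+1) = P_{r+1}(m) + P_r(m+1).

open import Defs
open import Data.Nat.Base
  using ( ℕ; zero; suc; _+_; _*_; _∸_; _^_; _!; _⊓_; _≤_; _<_; z≤n; s≤s; z<s
        ; NonZero; >-nonZero; >-nonZero⁻¹; nonTrivial⇒n>1)
open import Data.Nat.Primality using (Prime; prime⇒nonZero; prime⇒nonTrivial; euclidsLemma)
open import Data.Nat.Properties
open import Data.Nat.Divisibility
open import Data.Nat.DivMod
open import Data.Nat.Combinatorics using (_C_; nCk+nC[k+1]≡[n+1]C[k+1]; nCn≡1)
open import Data.Nat.Induction using (<-wellFounded)
open import Induction.WellFounded using (Acc; acc)
open import Algebra.Properties.CommutativeSemigroup +-commutativeSemigroup using (interchange)
open import Data.Product using (∃; _,_; proj₁; proj₂)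
open import Data.Sum using (inj₁; inj₂)
open import Function using (_∘_)
open import Relation.Nullary using (¬_; Dec; yes; no; contradiction)
open import Relation.Binary.PropositionalEquality
open ≡-Reasoning

sumTo-cong : ∀ x {f g : ℕ → ℕ} → (∀ i → i ≤ x → f i ≡ g i) → sumTo x f ≡ sumTo x g
sumTo-cong zero    f≗g = refl
sumTo-cong (suc x) f≗g =
  cong₂ _+_ (sumTo-cong x (λ i i≤x → f≗g i (m≤n⇒m≤1+n i≤x))) (f≗g (suc x) ≤-refl)

sumTo-+ : ∀ x (f g : ℕ → ℕ) → sumTo x (λ i → f i + g i) ≡ sumTo x f + sumTo x g
sumTo-+ zero    f g = refl
sumTo-+ (suc x) f g = begin
  sumTo x (λ i → f i + g i) + (f (suc x) + g (suc x))
    ≡⟨ cong (_+ (f (suc x) + g (suc x))) (sumTo-+ x f g) ⟩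
  (sumTo x f + sumTo x g) + (f (suc x) + g (suc x))
    ≡⟨ interchange (sumTo x f) (sumTo x g) (f (suc x)) (g (suc x)) ⟩
  sumTo (suc x) f + sumTo (suc x) g ∎

𝟙 : ∀ {a} {A : Set a} → Dec A → ℕ
𝟙 (yes _) = 1
𝟙 (no _)  = 0

sumTo-𝟙-≤ : ∀ v N → sumTo N (λ k → 𝟙 (k ≤? v)) ≡ N ⊓ v
sumTo-𝟙-≤ v zero    = refl
sumTo-𝟙-≤ v (suc N) = trans (cong (_+ 𝟙 (suc N ≤? v)) (sumTo-𝟙-≤ v N)) step
  where
  step : N ⊓ v + 𝟙 (suc N ≤? v) ≡ suc N ⊓ v
  step with suc N ≤? v
  ... | yes 1+N≤v = begin
    N ⊓ v + 1   ≡⟨ cong (_+ 1) (m≤n⇒m⊓n≡m (≤-trans (n≤1+n N) 1+N≤v)) ⟩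
    N + 1       ≡⟨ +-comm N 1 ⟩
    suc N       ≡⟨ m≤n⇒m⊓n≡m 1+N≤v ⟨
    suc N ⊓ v   ∎
  ... | no 1+N≰v = begin
    N ⊓ v + 0   ≡⟨ +-identityʳ (N ⊓ v) ⟩
    N ⊓ v       ≡⟨ m≥n⇒m⊓n≡n v≤N ⟩
    v           ≡⟨ m≥n⇒m⊓n≡n (m≤n⇒m≤1+n v≤N) ⟨
    suc N ⊓ v   ∎
    where v≤N = ≤-pred (≰⇒> 1+N≰v)

[r+a*n]/n≡a : ∀ r a n .{{_ : NonZero n}} → r < n → (r + a * n) / n ≡ a
[r+a*n]/n≡a r a n r<n = begin
  (r + a * n) / n     ≡⟨ +-distrib-/-∣ʳ r (n∣m*n a) ⟩
  r / n + a * n / n   ≡⟨ cong₂ _+_ (m<n⇒m/n≡0 r<n) (m*n/n≡m a n) ⟩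
  a                   ∎

n∣1+m⇒[1+m]/n≡1+m/n : ∀ m n .{{_ : NonZero n}} → n ∣ suc m → suc m / n ≡ suc (m / n)
n∣1+m⇒[1+m]/n≡1+m/n m n@(suc n-1) (divides (suc q) 1+m≡[1+q]n) = begin
  suc m / n                  ≡⟨ cong (_/ n) 1+m≡[1+q]n ⟩
  suc q * n / n              ≡⟨ m*n/n≡m (suc q) n ⟩
  suc q                      ≡⟨ cong suc ([r+a*n]/n≡a n-1 q n ≤-refl) ⟨
  suc ((n-1 + q * n) / n)    ≡⟨ cong (λ k → suc (k / n)) (suc-injective 1+m≡[1+q]n) ⟨
  suc (m / n)                ∎

-- Write 1+m = (1 + m%n) + (m/n)·n: the quotient grows exactly when 1 + m%n = n.
[1+m]/n≡m/n+𝟙[n∣1+m] : ∀ m n .{{_ : NonZero n}} → suc m / n ≡ m / n + 𝟙 (n ∣? suc m)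
[1+m]/n≡m/n+𝟙[n∣1+m] m n with n ∣? suc m | suc (m % n) ≟ n
... | yes n∣1+m | _ = trans (n∣1+m⇒[1+m]/n≡1+m/n m n n∣1+m) (+-comm 1 (m / n))
... | no n∤1+m | yes 1+m%n≡n =
  contradiction (divides (suc (m / n)) 1+m≡[1+m/n]n) n∤1+m
  where
  1+m≡[1+m/n]n : suc m ≡ suc (m / n) * n
  1+m≡[1+m/n]n = trans (cong suc (m≡m%n+[m/n]*n m n)) (cong (_+ m / n * n) 1+m%n≡n)
... | no _ | no 1+m%n≢n = begin
  suc m / n                     ≡⟨ cong (λ k → suc k / n) (m≡m%n+[m/n]*n m n) ⟩
  (suc (m % n) + m / n * n) / n ≡⟨ [r+a*n]/n≡a (suc (m % n)) (m / n) n (≤∧≢⇒< (m%n<n m n) 1+m%n≢n) ⟩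
  m / n                         ≡⟨ +-identityʳ (m / n) ⟨
  m / n + 0                     ∎

^-monoʳ-∣ : ∀ p {a b} → a ≤ b → p ^ a ∣ p ^ b
^-monoʳ-∣ p {b = b} z≤n       = 1∣ (p ^ b)
^-monoʳ-∣ p         (s≤s a≤b) = *-monoʳ-∣ p (^-monoʳ-∣ p a≤b)

n<m^n : ∀ {m} → 1 < m → ∀ n → n < m ^ n
n<m^n 1<m zero    = z<s
n<m^n 1<m (suc n) = ≤-<-trans (n<m^n 1<m n) (^-monoʳ-< _ 1<m (n<1+n n))

module _ {p m v : ℕ} (ν : IsValuation p m v) where

  𝟙[p^k∣m]≡𝟙[k≤v] : ∀ k → 𝟙 (p ^ k ∣? m) ≡ 𝟙 (k ≤? v)
  𝟙[p^k∣m]≡𝟙[k≤v] k with p ^ k ∣? m | k ≤? v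
  ... | yes _     | yes _   = refl
  ... | no p^k∤m  | yes k≤v = contradiction (∣-trans (^-monoʳ-∣ p k≤v) (ν .proj₁)) p^k∤m
  ... | yes p^k∣m | no k≰v  = contradiction (∣-trans (^-monoʳ-∣ p (≰⇒> k≰v)) p^k∣m) (ν .proj₂)
  ... | no _      | no _    = refl

  sumTo-𝟙[p^k∣m]≡N⊓v : ∀ N → sumTo N (λ k → 𝟙 (p ^ k ∣? m)) ≡ N ⊓ v
  sumTo-𝟙[p^k∣m]≡N⊓v N = trans (sumTo-cong N (λ k _ → 𝟙[p^k∣m]≡𝟙[k≤v] k)) (sumTo-𝟙-≤ v N)

P-pascal : ∀ r m → P (suc r) (suc (suc m)) ≡ P (suc r) (suc m) + P r (suc (suc m))
P-pascal r m = begin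
  suc n C suc r                          ≡⟨ nCk+nC[k+1]≡[n+1]C[k+1] n r ⟨
  n C r + n C suc r                      ≡⟨ +-comm (n C r) (n C suc r) ⟩
  n C suc r + n C r                      ≡⟨ cong (λ k → n C suc r + k C r) (+-suc m r) ⟩
  P (suc r) (suc m) + P r (suc (suc m))  ∎
  where n = m + suc r

P-pascal-∸ : ∀ r {x i} → i ≤ x →
  P (suc r) (suc x + 1 ∸ i) ≡ P (suc r) (x + 1 ∸ i) + P r (suc x + 1 ∸ i)
P-pascal-∸ r {x} {i} i≤x = begin
  P (suc r) (suc x + 1 ∸ i)                            ≡⟨ cong (P (suc r)) [2+x]∸i≡2+[x∸i] ⟩
  P (suc r) (suc (suc (x ∸ i)))                        ≡⟨ P-pascal r (x ∸ i) ⟩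
  P (suc r) (suc (x ∸ i)) + P r (suc (suc (x ∸ i)))
    ≡⟨ cong₂ (λ a b → P (suc r) a + P r b) [1+x]∸i≡1+[x∸i] [2+x]∸i≡2+[x∸i] ⟨
  P (suc r) (x + 1 ∸ i) + P r (suc x + 1 ∸ i)          ∎
  where
  [1+x]∸i≡1+[x∸i] : x + 1 ∸ i ≡ suc (x ∸ i)
  [1+x]∸i≡1+[x∸i] = trans (+-∸-comm 1 i≤x) (+-comm (x ∸ i) 1)
  [2+x]∸i≡2+[x∸i] : suc x + 1 ∸ i ≡ suc (suc (x ∸ i))
  [2+x]∸i≡2+[x∸i] = trans (+-∸-assoc 1 (≤-trans i≤x (m≤m+n x 1))) (cong suc [1+x]∸i≡1+[x∸i])

P-1 : ∀ r → P r 1 ≡ 1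
P-1 = nCn≡1

simplexSum : ℕ → (ℕ → ℕ) → ℕ → ℕ
simplexSum r f x = sumTo x (λ i → P r (x + 1 ∸ i) * f i)

simplexSum-zero : ∀ f x → simplexSum 0 f x ≡ sumTo x f
simplexSum-zero f x = sumTo-cong x (λ i _ → *-identityˡ (f i))

simplexSum-suc : ∀ r f x →
  simplexSum (suc r) f (suc x) ≡ simplexSum (suc r) f x + simplexSum r f (suc x)
simplexSum-suc r f x = begin
  sumTo x (λ i → P (suc r) (suc x + 1 ∸ i) * f i) + P (suc r) (suc x + 1 ∸ suc x) * f (suc x)
    ≡⟨ cong₂ _+_ (trans (sumTo-cong x pascal) (sumTo-+ x _ _)) (cong (_* f (suc x)) last) ⟩
  (simplexSum (suc r) f x + sumTo x (λ i → P r (suc x + 1 ∸ i) * f i)) + P r (suc x + 1 ∸ suc x) * f (suc x)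
    ≡⟨ +-assoc (simplexSum (suc r) f x) _ _ ⟩
  simplexSum (suc r) f x + simplexSum r f (suc x) ∎
  where
  pascal : ∀ i → i ≤ x →
    P (suc r) (suc x + 1 ∸ i) * f i ≡ P (suc r) (x + 1 ∸ i) * f i + P r (suc x + 1 ∸ i) * f i
  pascal i i≤x = trans (cong (_* f i) (P-pascal-∸ r i≤x))
    (*-distribʳ-+ (f i) (P (suc r) (x + 1 ∸ i)) (P r (suc x + 1 ∸ i)))
  [1+x+1]∸[1+x]≡1 : suc x + 1 ∸ suc x ≡ 1
  [1+x+1]∸[1+x]≡1 = m+n∸m≡n (suc x) 1
  last : P (suc r) (suc x + 1 ∸ suc x) ≡ P r (suc x + 1 ∸ suc x)
  last = begin
    P (suc r) (suc x + 1 ∸ suc x)  ≡⟨ cong (P (suc r)) [1+x+1]∸[1+x]≡1 ⟩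
    P (suc r) 1                    ≡⟨ trans (P-1 (suc r)) (sym (P-1 r)) ⟩
    P r 1                          ≡⟨ cong (P r) [1+x+1]∸[1+x]≡1 ⟨
    P r (suc x + 1 ∸ suc x)        ∎

sumTo-simplexSum : ∀ r f x → sumTo x (simplexSum r f) ≡ simplexSum (suc r) f x
sumTo-simplexSum r f zero    = refl
sumTo-simplexSum r f (suc x) =
  trans (cong (_+ simplexSum r f (suc x)) (sumTo-simplexSum r f x)) (sym (simplexSum-suc r f x))

module _ {p : ℕ} (pp : Prime p) where

  private instance
    p≢0 : NonZero p
    p≢0 = prime⇒nonZero pp

  private
    1<p : 1 < p
    1<p = nonTrivial⇒n>1 p {{prime⇒nonTrivial pp}}

    _/p^_ : ℕ → ℕ → ℕ
    m /p^ k = _/_ m (p ^ k) {{m^n≢0 p k}}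

  IsValuation-1 : IsValuation p 1 0
  IsValuation-1 = 1∣ 1 , >⇒∤ 1<p ∘ m*n∣⇒m∣ p 1

  IsValuation-p : IsValuation p p 1
  IsValuation-p = ∣-reflexive (*-identityʳ p) , λ p²∣p →
    IsValuation-1 .proj₂ (*-cancelˡ-∣ p (subst (p ^ 2 ∣_) (sym (*-identityʳ p)) p²∣p))

  IsValuation-* : ∀ u v {a b} →
    IsValuation p a u → IsValuation p b v → IsValuation p (a * b) (u + v)
  IsValuation-* u v {a} {b} (divides a′ a≡a′p^u , p^1+u∤a) (divides b′ b≡b′p^v , p^1+v∤b) =
    divides (a′ * b′) ab≡a′b′p^[u+v] , p^1+u+v∤ab
    where
    ab≡a′b′p^[u+v] : a * b ≡ a′ * b′ * p ^ (u + v)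
    ab≡a′b′p^[u+v] = begin
      a * b                        ≡⟨ cong₂ _*_ a≡a′p^u b≡b′p^v ⟩
      a′ * p ^ u * (b′ * p ^ v)    ≡⟨ [m*n]*[o*p]≡[m*o]*[n*p] a′ (p ^ u) b′ (p ^ v) ⟩
      a′ * b′ * (p ^ u * p ^ v)    ≡⟨ cong (a′ * b′ *_) (^-distribˡ-+-* p u v) ⟨
      a′ * b′ * p ^ (u + v)        ∎
    p^1+u+v∤ab : ¬ p ^ suc (u + v) ∣ a * b
    p^1+u+v∤ab p^1+u+v∣ab with euclidsLemma a′ b′ pp p∣a′b′
      where
      p∣a′b′ : p ∣ a′ * b′
      p∣a′b′ = *-cancelʳ-∣ (p ^ (u + v)) {{m^n≢0 p (u + v)}}
        (subst (p ^ suc (u + v) ∣_) ab≡a′b′p^[u+v] p^1+u+v∣ab)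
    ... | inj₁ p∣a′ = p^1+u∤a (subst (p ^ suc u ∣_) (sym a≡a′p^u) (*-monoˡ-∣ (p ^ u) p∣a′))
    ... | inj₂ p∣b′ = p^1+v∤b (subst (p ^ suc v ∣_) (sym b≡b′p^v) (*-monoˡ-∣ (p ^ v) p∣b′))

  IsValuation-prodTo : ∀ x {f g : ℕ → ℕ} → (∀ i → IsValuation p (f i) (g i)) →
    IsValuation p (prodTo x f) (sumTo x g)
  IsValuation-prodTo zero    ν = IsValuation-1
  IsValuation-prodTo (suc x) {g = g} ν =
    IsValuation-* (sumTo x g) (g (suc x)) (IsValuation-prodTo x ν) (ν (suc x))

  valuation : ∀ {m} → Acc _<_ m → 0 < m → ∃ (IsValuation p m)
  valuation {m} (acc rs) 0<m with p ∣? m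
  ... | no p∤m = 0 , 1∣ m , p∤m ∘ m*n∣⇒m∣ p 1
  ... | yes (divides q refl) =
    let instance q≢0 = m*n≢0⇒m≢0 q {{>-nonZero 0<m}}
        (v , ν) = valuation (rs (m<m*n q p 1<p)) (>-nonZero⁻¹ q)
    in v + 1 , IsValuation-* v 1 ν IsValuation-p

  legendreSum-suc : ∀ {x v} → IsValuation p (suc x) v → legendreSum p (suc x) ≡ v + legendreSum p x
  legendreSum-suc {x} {v} ν = begin
    sumTo (suc x) (λ k → suc x /p^ k)
      ≡⟨ sumTo-cong (suc x) (λ k _ → [1+m]/n≡m/n+𝟙[n∣1+m] x (p ^ k) {{m^n≢0 p k}}) ⟩
    sumTo (suc x) (λ k → x /p^ k + 𝟙 (p ^ k ∣? suc x))
      ≡⟨ sumTo-+ (suc x) (x /p^_) (λ k → 𝟙 (p ^ k ∣? suc x)) ⟩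
    (legendreSum p x + x /p^ suc x) + sumTo (suc x) (λ k → 𝟙 (p ^ k ∣? suc x))
      ≡⟨ cong₂ _+_ (cong (legendreSum p x +_) x/p^[1+x]≡0) (sumTo-𝟙[p^k∣m]≡N⊓v ν (suc x)) ⟩
    (legendreSum p x + 0) + suc x ⊓ v
      ≡⟨ cong₂ _+_ (+-identityʳ (legendreSum p x)) (m≥n⇒m⊓n≡n v≤1+x) ⟩
    legendreSum p x + v
      ≡⟨ +-comm (legendreSum p x) v ⟩
    v + legendreSum p x ∎
    where
    x/p^[1+x]≡0 : x /p^ suc x ≡ 0
    x/p^[1+x]≡0 = m<n⇒m/n≡0 {{m^n≢0 p (suc x)}} (<-trans (n<1+n x) (n<m^n 1<p (suc x)))
    v≤1+x : v ≤ suc x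
    v≤1+x = <⇒≤ (<-≤-trans (n<m^n 1<p v) (∣⇒≤ (ν .proj₁)))

  legendre : ∀ x → IsValuation p (x !) (legendreSum p x)
  legendre zero    = IsValuation-1
  legendre (suc x) =
    let (v , ν) = valuation (<-wellFounded (suc x)) z<s
    in subst (IsValuation p (suc x !)) (sym (legendreSum-suc {v = v} ν))
         (IsValuation-* v (legendreSum p x) ν (legendre x))

  IsValuation-sf : ∀ r x → IsValuation p (sf (suc r) x) (simplexSum r (legendreSum p) x)
  IsValuation-sf zero    x =
    subst (IsValuation p (sf 1 x)) (sym (simplexSum-zero (legendreSum p) x))
      (IsValuation-prodTo x legendre)
  IsValuation-sf (suc r) x =
    subst (IsValuation p (sf (suc (suc r)) x)) (sumTo-simplexSum r (legendreSum p) x)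
      (IsValuation-prodTo x (IsValuation-sf r))

theorem8p1 : (p : ℕ) → (pp : Prime p) → (x n : ℕ) → 1 ≤ x → 1 ≤ n →
    IsValuation p (sf n x)
      (sumTo x (λ i → P (n ∸ 1) (x + 1 ∸ i) * legendreSum p {{prime⇒nonZero pp}} i))
theorem8p1 p pp x (suc r) _ _ = IsValuation-sf pp r x
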